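{- Let $w_n$ be the number of weak-ordering chains in $\mathcal{WOC}(n)$ subject to the stopping condition $x_i=x_j$ with $i\neq j$ (i.e. a chain contains the stopping condition if two distinct variables are equal in it). Then $w_n = 2\,n!-1$ for all $n\ge 1$. The sequence starts $1,3,11,47,239,1439,10079,80639,\dots$.
   Context: A weak-ordering chain on $x_1,\dots,x_m$ is an expression $x_{i_1}\,\mathrm{op}\,x_{i_2}\,\mathrm{op}\cdots\mathrm{op}\,x_{i_m}$, where $(i_1,\dots,i_m)$ is an ordering of $[m]=\{1,\dots,m\}$ and each $\mathrm{op}$ is $<$ or $=$; two expressions defining the same ordered set partition of $[m]$ (blocks = index sets of equal variables, ordered by increasing value) are identified. $\mathcal{WOC}(m)$ is the set of these chains. Each chain in $\mathcal{WOC}(m)$, $m\ge 2$, arises uniquely from its restriction to $x_1,\dots,x_{m-1}$ (a chain in $\mathcal{WOC}(m-1)$) by inserting $x_m$ (either as equal to an existing class or as a new class in some position); this gives a rooted tree with root $x_1$ whose level-$m$ nodes are the elements of $\mathcal{WOC}(m)$. Given a stopping condition, the restricted generating tree of order $n$ is the part of this tree up to level $n$ in which any node whose chain contains the stopping condition has no descendants. Its leaves are the nodes at level $n$ together with the nodes containing the stopping condition. "The number of weak-ordering chains in $\mathcal{WOC}(n)$ subject to the stopping condition" means the number of leaves of this restricted tree of order $n$; equivalently, the number of chains in $\mathcal{WOC}(n)$ not containing the condition plus, for each $1\le j\le n$, the number of chains in $\mathcal{WOC}(j)$ that contain the condition while their restriction to $x_1,\dots,x_{j-1}$ does not. -}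

module Defs where

open import Data.Nat using (ℕ; zero; suc; _≤ᵇ_; _≡ᵇ_; _∸_)
open import Data.Bool using (Bool; true; false; if_then_else_; _∨_)
open import Data.List using (List; []; _∷_; _++_; [_]; map; upTo)
open import Data.Nat.ListAction using (sum)
open import Data.Bool.ListAction using (any)
open import Data.Product using (_×_; _,_)

-- A weak-ordering chain in WOC(m) (an ordered set partition of [m]) is encoded
-- by its number k of blocks together with its rank word w of length m:
-- the i-th entry of w (0-based) is the index (0..k-1) of the block containing
-- x_{i+1}, blocks ordered by increasing value.  Every value 0..k-1 occurs.
Chain : Set
Chain = ℕ × List ℕ

root : Chain
root = 1 , 0 ∷ []

insertEq : Chain → ℕ → Chain
insertEq (k , w) c = k , (w ++ [ c ])

insertNew : Chain → ℕ → Chain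
insertNew (k , w) p = suc k , (map (λ v → if p ≤ᵇ v then suc v else v) w ++ [ p ])

children : Chain → List Chain
children (k , w) = map (insertEq (k , w)) (upTo k) ++ map (insertNew (k , w)) (upTo (suc k))

hasDup : List ℕ → Bool
hasDup []       = false
hasDup (x ∷ xs) = any (x ≡ᵇ_) xs ∨ hasDup xs

-- Stopping condition: x_i = x_j for some i ≠ j, i.e. two distinct variables
-- lie in the same block.
stops : Chain → Bool
stops (k , w) = hasDup w

leaves : ℕ → Chain → ℕ
leaves r c with stops c
... | true  = 1
leaves zero    c | false = 1
leaves (suc r) c | false = sum (map (leaves r) (children c))

-- w_n : number of leaves of the restricted generating tree of order n
-- (root at level 1).
w : ℕ → ℕ
w n = leaves (n ∸ 1) root

-- A chain that does not stop is strict: all its blocks are singletons, so it is a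
-- permutation of [m].  Of the 2k+1 children of a strict chain with k blocks, the k
-- obtained by making x_{m+1} equal to an existing variable stop at once, and the
-- k+1 obtained by opening a new block are again strict.  Hence the leaves below
-- such a chain satisfy  L(0,k) = 1,  L(r+1,k) = k + (k+1) L(r,k+1),  which solves
-- to  (L(r,k) + 1) k! = 2 (r+k)!;  at the root (k = 1, r = n-1) this is 2 n! - 1.
module Submission where

open import Defs
open import Data.Nat using (ℕ; zero; suc; _+_; _*_; _∸_; _≤_; _<_; _≤ᵇ_; _≡ᵇ_; _!; s≤s; s≤s⁻¹)
open import Data.Nat.Properties
open import Data.Bool using (true; false; if_then_else_; _∨_)
open import Data.Bool.Properties using (∨-zeroʳ)
open import Data.Bool.ListAction using (any)
open import Data.List using ([]; _∷_; _++_; [_]; map; upTo; length)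
open import Data.List.Properties using (map-++; map-∘; length-upTo)
open import Data.Nat.ListAction using (sum)
open import Data.Nat.ListAction.Properties using (sum-++)
open import Data.List.Membership.Propositional using (_∈_)
open import Data.List.Membership.Propositional.Properties
  using (∈-map⁺; ∈-map⁻; ∈-++⁺ˡ; ∈-++⁺ʳ; ∈-upTo⁻)
open import Data.List.Relation.Unary.All using (All; []; _∷_)
open import Data.List.Relation.Unary.AllPairs using ([]; _∷_)
open import Data.List.Relation.Unary.Any using (here; there)
open import Data.List.Relation.Unary.Unique.Propositional using (Unique)
import Data.List.Relation.Unary.Unique.Propositional.Properties as Unique
open import Data.Product using (_×_; _,_; ∃-syntax)
open import Data.Sum using (_⊎_; inj₁; inj₂)
open import Data.Empty using (⊥; ⊥-elim)
open import Function using (_∘_)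
open import Relation.Nullary using (yes; no; ofʸ; ofⁿ)
open import Relation.Nullary.Decidable using (dec-true; dec-false)
open import Relation.Binary using (tri<; tri≈; tri>)
open import Relation.Binary.PropositionalEquality
  using (_≡_; _≢_; refl; sym; trans; cong; cong₂; module ≡-Reasoning)

-- The relabelling performed by insertNew, so insertNew (k , w) p reduces to
-- (suc k , map (shift p) w ++ [ p ]).
shift : ℕ → ℕ → ℕ
shift p v = if p ≤ᵇ v then suc v else v

shift-cases : ∀ p v → (p ≤ v × shift p v ≡ suc v) ⊎ (v < p × shift p v ≡ v)
shift-cases p v with p ≤ᵇ v | ≤ᵇ-reflects-≤ p v
... | true  | ofʸ p≤v = inj₁ (p≤v , refl)
... | false | ofⁿ p≰v = inj₂ (≰⇒> p≰v , refl)

shift-≢ : ∀ p v → shift p v ≢ p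
shift-≢ p v eq with shift-cases p v
... | inj₁ (p≤v , e) = <⇒≢ (s≤s p≤v) (sym (trans (sym e) eq))
... | inj₂ (v<p , e) = <⇒≢ v<p (trans (sym e) eq)

shift-injective : ∀ p {x y} → shift p x ≡ shift p y → x ≡ y
shift-injective p {x} {y} eq with shift-cases p x | shift-cases p y
... | inj₁ (_ , ex) | inj₁ (_ , ey) = suc-injective (trans (sym ex) (trans eq ey))
... | inj₂ (_ , ex) | inj₂ (_ , ey) = trans (sym ex) (trans eq ey)
... | inj₁ (p≤x , ex) | inj₂ (y<p , ey) =
  ⊥-elim (<-asym (<-≤-trans y<p p≤x) (≤-reflexive (trans (sym ex) (trans eq ey))))
... | inj₂ (x<p , ex) | inj₁ (p≤y , ey) =
  ⊥-elim (<-asym (<-≤-trans x<p p≤y) (≤-reflexive (trans (sym ey) (trans (sym eq) ex))))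

shift-preimage : ∀ {p k c} → p ≤ k → c < suc k → c ≢ p → ∃[ c′ ] c′ < k × shift p c′ ≡ c
shift-preimage {p} {k} {c} p≤k c<1+k c≢p with <-cmp c p
... | tri≈ _ c≡p _ = ⊥-elim (c≢p c≡p)
... | tri< c<p _ _ with shift-cases p c
...   | inj₁ (p≤c , _) = ⊥-elim (<-irrefl refl (<-≤-trans c<p p≤c))
...   | inj₂ (_ , e)   = c , <-≤-trans c<p p≤k , e
shift-preimage {p} {k} {suc c′} p≤k (s≤s c′<k) c≢p | tri> _ _ p<c with shift-cases p c′
...   | inj₁ (_ , e)    = c′ , c′<k , e
...   | inj₂ (c′<p , _) = ⊥-elim (<-irrefl refl (<-≤-trans c′<p (s≤s⁻¹ p<c)))

any-≡ᵇ-∈ : ∀ {x xs} → x ∈ xs → any (x ≡ᵇ_) xs ≡ true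
any-≡ᵇ-∈ {x} (here refl) rewrite dec-true (x ≟ x) refl = refl
any-≡ᵇ-∈ {x} {y ∷ _} (there x∈xs) = trans (cong ((x ≡ᵇ y) ∨_) (any-≡ᵇ-∈ x∈xs)) (∨-zeroʳ _)

any-≡ᵇ-∉ : ∀ {x xs} → All (x ≢_) xs → any (x ≡ᵇ_) xs ≡ false
any-≡ᵇ-∉ [] = refl
any-≡ᵇ-∉ {x} {y ∷ _} (x≢y ∷ x∉xs)
  rewrite dec-false (x ≟ y) x≢y | any-≡ᵇ-∉ x∉xs = refl

hasDup-unique : ∀ {xs} → Unique xs → hasDup xs ≡ false
hasDup-unique [] = refl
hasDup-unique (x∉xs ∷ u) rewrite any-≡ᵇ-∉ x∉xs | hasDup-unique u = refl

hasDup-∷ʳ-∈ : ∀ {c xs} → c ∈ xs → hasDup (xs ++ [ c ]) ≡ true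
hasDup-∷ʳ-∈ {c} {_ ∷ xs} (here refl)
  rewrite any-≡ᵇ-∈ {c} {xs ++ [ c ]} (∈-++⁺ʳ xs (here refl)) = refl
hasDup-∷ʳ-∈ (there c∈xs) rewrite hasDup-∷ʳ-∈ c∈xs = ∨-zeroʳ _

Strict : Chain → Set
Strict (k , w) = (∀ c → c < k → c ∈ w) × Unique w

root-strict : Strict root
root-strict = (λ { zero _ → here refl ; (suc _) (s≤s ()) }) , ([] ∷ [])

insertEq-stops : ∀ {k w c} → Strict (k , w) → c < k → stops (insertEq (k , w) c) ≡ true
insertEq-stops (covers , _) c<k = hasDup-∷ʳ-∈ (covers _ c<k)

insertNew-strict : ∀ {k w p} → Strict (k , w) → p ≤ k → Strict (insertNew (k , w) p)
insertNew-strict {k} {w} {p} (covers , unique) p≤k = covers′ , unique′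
  where
  covers′ : ∀ c → c < suc k → c ∈ map (shift p) w ++ [ p ]
  covers′ c c<1+k with c ≟ p
  ... | yes refl = ∈-++⁺ʳ (map (shift p) w) (here refl)
  ... | no c≢p with shift-preimage p≤k c<1+k c≢p
  ...   | c′ , c′<k , refl = ∈-++⁺ˡ (∈-map⁺ (shift p) (covers c′ c′<k))

  p∉shifted : ∀ {v} → v ∈ map (shift p) w × v ∈ [ p ] → ⊥
  p∉shifted (v∈ , here refl) with ∈-map⁻ (shift p) v∈
  ... | x , _ , eq = shift-≢ p x (sym eq)

  unique′ : Unique (map (shift p) w ++ [ p ])
  unique′ = Unique.++⁺ (Unique.map⁺ (shift-injective p) unique) ([] ∷ []) p∉shifted

leaves-stop : ∀ r c → stops c ≡ true → leaves r c ≡ 1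
leaves-stop r c s with stops c
leaves-stop r c refl | true = refl

leaves-zero : ∀ c → stops c ≡ false → leaves zero c ≡ 1
leaves-zero c s with stops c
leaves-zero c refl | false = refl

leaves-suc : ∀ r c → stops c ≡ false → leaves (suc r) c ≡ sum (map (leaves r) (children c))
leaves-suc r c s with stops c
leaves-suc r c refl | false = refl

sum-map-children : ∀ (f : Chain → ℕ) k w →
  sum (map f (children (k , w))) ≡
  sum (map (f ∘ insertEq (k , w)) (upTo k)) + sum (map (f ∘ insertNew (k , w)) (upTo (suc k)))
sum-map-children f k w = begin
  sum (map f (eqs ++ news))             ≡⟨ cong sum (map-++ f eqs news) ⟩
  sum (map f eqs ++ map f news)         ≡⟨ sum-++ (map f eqs) (map f news) ⟩
  sum (map f eqs) + sum (map f news)    ≡⟨ cong₂ _+_ (cong sum (sym (map-∘ (upTo k))))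
                                                     (cong sum (sym (map-∘ (upTo (suc k))))) ⟩
  sum (map (f ∘ insertEq (k , w)) (upTo k)) + sum (map (f ∘ insertNew (k , w)) (upTo (suc k))) ∎
  where
  open ≡-Reasoning
  eqs = map (insertEq (k , w)) (upTo k)
  news = map (insertNew (k , w)) (upTo (suc k))

sum-map-const : ∀ {A : Set} (f : A → ℕ) a xs → (∀ {x} → x ∈ xs → f x ≡ a) → sum (map f xs) ≡ length xs * a
sum-map-const f a [] _ = refl
sum-map-const f a (x ∷ xs) f≡a = cong₂ _+_ (f≡a (here refl)) (sum-map-const f a xs (f≡a ∘ there))

sum-upTo-const : ∀ (f : ℕ → ℕ) a n → (∀ {i} → i < n → f i ≡ a) → sum (map f (upTo n)) ≡ n * a
sum-upTo-const f a n f≡a = trans (sum-map-const f a (upTo n) (f≡a ∘ ∈-upTo⁻))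
                                 (cong (_* a) (length-upTo n))

strictLeaves : ℕ → ℕ → ℕ
strictLeaves zero    k = 1
strictLeaves (suc r) k = k + suc k * strictLeaves r (suc k)

leaves-strict : ∀ r {k w} → Strict (k , w) → leaves r (k , w) ≡ strictLeaves r k
leaves-strict zero    {k} {w} (_ , unique) = leaves-zero (k , w) (hasDup-unique unique)
leaves-strict (suc r) {k} {w} strict@(_ , unique) = begin
  leaves (suc r) (k , w)
    ≡⟨ leaves-suc r (k , w) (hasDup-unique unique) ⟩
  sum (map (leaves r) (children (k , w)))
    ≡⟨ sum-map-children (leaves r) k w ⟩
  sum (map (leaves r ∘ insertEq (k , w)) (upTo k)) + sum (map (leaves r ∘ insertNew (k , w)) (upTo (suc k)))
    ≡⟨ cong₂ _+_ (sum-upTo-const (leaves r ∘ insertEq (k , w)) 1 k stopped)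
                 (sum-upTo-const (leaves r ∘ insertNew (k , w)) (strictLeaves r (suc k)) (suc k) continued) ⟩
  k * 1 + suc k * strictLeaves r (suc k)
    ≡⟨ cong (_+ suc k * strictLeaves r (suc k)) (*-identityʳ k) ⟩
  strictLeaves (suc r) k ∎
  where
  open ≡-Reasoning
  stopped : ∀ {c} → c < k → leaves r (insertEq (k , w) c) ≡ 1
  stopped {c} c<k = leaves-stop r (insertEq (k , w) c) (insertEq-stops strict c<k)
  continued : ∀ {p} → p < suc k → leaves r (insertNew (k , w) p) ≡ strictLeaves r (suc k)
  continued (s≤s p≤k) = leaves-strict r (insertNew-strict strict p≤k)

strictLeaves-factorial : ∀ r k → suc (strictLeaves r k) * k ! ≡ 2 * (r + k) !
strictLeaves-factorial zero    k = refl
strictLeaves-factorial (suc r) k = begin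
  suc (k + suc k * L) * k !    ≡⟨ cong (_* k !) (sym (*-suc (suc k) L)) ⟩
  suc k * suc L * k !          ≡⟨ cong (_* k !) (*-comm (suc k) (suc L)) ⟩
  suc L * suc k * k !          ≡⟨ *-assoc (suc L) (suc k) (k !) ⟩
  suc L * suc k !              ≡⟨ strictLeaves-factorial r (suc k) ⟩
  2 * (r + suc k) !            ≡⟨ cong (λ m → 2 * m !) (+-suc r k) ⟩
  2 * (suc r + k) !            ∎
  where
  open ≡-Reasoning
  L = strictLeaves r (suc k)

theorem1 : (n : ℕ) → 1 ≤ n → w n ≡ 2 * n ! ∸ 1
theorem1 (suc r) _ = begin
  leaves r root           ≡⟨ leaves-strict r root-strict ⟩
  strictLeaves r 1        ≡⟨ cong (_∸ 1) closedForm ⟩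
  2 * suc r ! ∸ 1         ∎
  where
  open ≡-Reasoning
  closedForm : suc (strictLeaves r 1) ≡ 2 * suc r !
  closedForm = begin
    suc (strictLeaves r 1)       ≡⟨ *-identityʳ _ ⟨
    suc (strictLeaves r 1) * 1   ≡⟨ strictLeaves-factorial r 1 ⟩
    2 * (r + 1) !                ≡⟨ cong (λ m → 2 * m !) (+-comm r 1) ⟩
    2 * suc r !                  ∎
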